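{- Let $\mathcal{M}=\langle M,\in^{\mathcal{M}}\rangle$ be a model of $\mathrm{AS}$. Then $\mathcal{M}\models\mathrm{BAS}$ if and only if $\langle M,\subseteq^{\mathcal{M}}\rangle\models\mathrm{Mer}$.
   Context: $\mathrm{AS}$ (Adjunctive Set Theory) is the theory in the language $\{\in\}$ with axioms (Emp) $\exists x\forall y(y\notin x)$ and (Adj) $\forall x\forall y\exists z\forall u(u\in z\iff(u\in x\lor u=y))$. $\mathrm{BAS}$ extends $\mathrm{AS}$ with: (Ext) $\forall x\forall y(x=y\iff\forall z(z\in x\iff z\in y))$; (Union) $\forall x\forall y\exists z\forall u(u\in z\iff u\in x\lor u\in y)$; (Intersection) $\forall x\forall y\exists z\forall u(u\in z\iff u\in x\land u\in y)$; (RelComp) $\forall x\forall y\exists z\forall u(u\in z\iff u\in x\land u\notin y)$; (UB) $\forall x\exists y(y\notin x)$. $a\subseteq^{\mathcal{M}}b$ iff for all $c\in M$, $c\in^{\mathcal{M}}a$ implies $c\in^{\mathcal{M}}b$. $\mathrm{Mer}$ is the theory, in the language with one binary relation $\sqsubseteq$, of atomic unbounded relatively complemented distributive lattices: $\sqsubseteq$ is a partial order with a least element $0$ in which any two elements have a least upper bound $\dot\lor$ and a greatest lower bound $\dot\land$; every nonzero element has an atom (a nonzero $a$ with only $0$ and $a$ below it) below it; every $x$ has some $y\ne x$ with $x\sqsubseteq y$; for all $x,y$ there is $z$ with $y\dot\land z=0$ and $x=(x\dot\land y)\dot\lor z$; both distributive laws hold. -}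

module Defs where

open import Data.Product using (Σ; ∃; _×_; _,_; proj₁; proj₂)
open import Data.Sum using (_⊎_)
open import Relation.Nullary using (¬_; Dec)
open import Relation.Binary.PropositionalEquality using (_≡_; _≢_)
open import Function.Bundles using (_⇔_)

LEM : Set₁
LEM = (P : Set) → Dec P

-- The language {∈}: a structure is a carrier M with a binary relation.
-- Equality of the object language is interpreted as _≡_ on M.

module _ {M : Set} (_∈_ : M → M → Set) where

  Emp : Set
  Emp = ∃ λ x → ∀ y → ¬ (y ∈ x)

  Adj : Set
  Adj = ∀ x y → ∃ λ z → ∀ u → (u ∈ z ⇔ (u ∈ x ⊎ u ≡ y))

  AS : Set
  AS = Emp × Adj

  Ext : Set
  Ext = ∀ x y → (x ≡ y ⇔ (∀ z → (z ∈ x ⇔ z ∈ y)))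

  Union : Set
  Union = ∀ x y → ∃ λ z → ∀ u → (u ∈ z ⇔ (u ∈ x ⊎ u ∈ y))

  Intersection : Set
  Intersection = ∀ x y → ∃ λ z → ∀ u → (u ∈ z ⇔ (u ∈ x × u ∈ y))

  RelComp : Set
  RelComp = ∀ x y → ∃ λ z → ∀ u → (u ∈ z ⇔ (u ∈ x × ¬ (u ∈ y)))

  UB : Set
  UB = ∀ x → ∃ λ y → ¬ (y ∈ x)

  BAS : Set
  BAS = AS × Ext × Union × Intersection × RelComp × UB

  _⊆_ : M → M → Set
  a ⊆ b = ∀ c → c ∈ a → c ∈ b

module _ {A : Set} (_⊑_ : A → A → Set) where

  IsLeast : A → Set
  IsLeast z = ∀ x → z ⊑ x

  IsLub : A → A → A → Set
  IsLub x y s = x ⊑ s × y ⊑ s × (∀ w → x ⊑ w → y ⊑ w → s ⊑ w)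

  IsGlb : A → A → A → Set
  IsGlb x y m = m ⊑ x × m ⊑ y × (∀ w → w ⊑ x → w ⊑ y → w ⊑ m)

  -- The least element, joins and meets are (unique, by antisymmetry)
  -- witnesses of the existence axioms; the remaining axioms are
  -- phrased using these witnesses.
  record Mer : Set where
    field
      ⊑-refl    : ∀ x → x ⊑ x
      ⊑-trans   : ∀ x y z → x ⊑ y → y ⊑ z → x ⊑ z
      ⊑-antisym : ∀ x y → x ⊑ y → y ⊑ x → x ≡ y
      least     : Σ A IsLeast
      join      : ∀ x y → Σ A (IsLub x y)
      meet      : ∀ x y → Σ A (IsGlb x y)

    𝟘 : A
    𝟘 = proj₁ least

    _∨̇_ : A → A → A
    x ∨̇ y = proj₁ (join x y)

    _∧̇_ : A → A → A
    x ∧̇ y = proj₁ (meet x y)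

    IsAtom : A → Set
    IsAtom a = a ≢ 𝟘 × (∀ b → b ⊑ a → b ≡ 𝟘 ⊎ b ≡ a)

    field
      atomic      : ∀ x → x ≢ 𝟘 → ∃ λ a → IsAtom a × a ⊑ x
      unbounded   : ∀ x → ∃ λ y → y ≢ x × x ⊑ y
      relCompl    : ∀ x y → ∃ λ z → (y ∧̇ z ≡ 𝟘) × (x ≡ (x ∧̇ y) ∨̇ z)
      distrib-∧∨  : ∀ x y z → x ∧̇ (y ∨̇ z) ≡ (x ∧̇ y) ∨̇ (x ∧̇ z)
      distrib-∨∧  : ∀ x y z → x ∨̇ (y ∧̇ z) ≡ (x ∨̇ y) ∧̇ (x ∨̇ z)

module Submission where

-- Over AS the singletons ⟦ c ⟧ = adj(∅, c) satisfy ⟦ c ⟧ ⊆ x iff c ∈ x, so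
-- greatest lower bounds for ⊆ are exactly intersections.  Given BAS, unions,
-- intersections and differences therefore make ⊆ an extensional lattice of
-- sets, distributive because ∧ and ∨ are computed pointwise, with the
-- singletons as atoms.  Conversely, in a Mer lattice the join x ∨ y is the
-- union of x and y: an element c of x ∨ y outside both would be missed by
-- the relative complement of ⟦ c ⟧ in x ∨ y, which by distributivity lies
-- above x and y.

open import Defs
open import Data.Empty using (⊥-elim)
open import Data.Product using (∃; _×_; _,_; proj₁; proj₂)
open import Data.Product.Algebra using (×-distribˡ-⊎)
open import Data.Product.Function.NonDependent.Propositional using (_×-⇔_)
open import Data.Sum using (_⊎_; inj₁; inj₂; [_,_])
open import Data.Sum.Function.Propositional using (_⊎-⇔_)
open import Function using (id; _∘_)
open import Function.Bundles using (_⇔_; mk⇔; Equivalence)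
open import Function.Construct.Identity using (⇔-id)
open import Function.Construct.Symmetry using (⇔-sym)
open import Function.Related.Propositional using (equivalence; module EquationalReasoning)
open import Relation.Nullary using (¬_; yes; no)
open import Relation.Nullary.Decidable using (decidable-stable)
open import Relation.Binary.PropositionalEquality using (_≡_; _≢_; refl; sym; subst)

open Equivalence using (to; from)

⊎-distribˡ-× : {A B C : Set} → (A ⊎ (B × C)) ⇔ ((A ⊎ B) × (A ⊎ C))
⊎-distribˡ-× = mk⇔ [ (λ a → inj₁ a , inj₁ a) , (λ (b , c) → inj₂ b , inj₂ c) ] λ
  { (inj₁ a , _)      → inj₁ a
  ; (inj₂ _ , inj₁ a) → inj₁ a
  ; (inj₂ b , inj₂ c) → inj₂ (b , c)
  }

module MerProperties {A : Set} {_⊑_ : A → A → Set} (mer : Mer _⊑_) where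
  open Mer mer

  x⊑x∨̇y : ∀ x y → x ⊑ (x ∨̇ y)
  x⊑x∨̇y x y = proj₁ (proj₂ (join x y))

  y⊑x∨̇y : ∀ x y → y ⊑ (x ∨̇ y)
  y⊑x∨̇y x y = proj₁ (proj₂ (proj₂ (join x y)))

  ∨̇-least : ∀ {x y w} → x ⊑ w → y ⊑ w → (x ∨̇ y) ⊑ w
  ∨̇-least {x} {y} {w} = proj₂ (proj₂ (proj₂ (join x y))) w

  x∧̇y⊑y : ∀ x y → (x ∧̇ y) ⊑ y
  x∧̇y⊑y x y = proj₁ (proj₂ (proj₂ (meet x y)))

  ∧̇-greatest : ∀ {x y w} → w ⊑ x → w ⊑ y → w ⊑ (x ∧̇ y)
  ∧̇-greatest {x} {y} {w} = proj₂ (proj₂ (proj₂ (meet x y))) w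

  ⊑-∨̇-cancelˡ : ∀ {w t z} → w ⊑ (t ∨̇ z) → (w ∧̇ t) ⊑ z → w ⊑ z
  ⊑-∨̇-cancelˡ {w} {t} {z} w⊑t∨̇z w∧̇t⊑z =
    ⊑-trans w (w ∧̇ (t ∨̇ z)) z (∧̇-greatest (⊑-refl w) w⊑t∨̇z)
      (subst (_⊑ z) (sym (distrib-∧∨ w t z)) (∨̇-least w∧̇t⊑z (x∧̇y⊑y w z)))

module Membership {M : Set} (_∈_ : M → M → Set) where

  infix 4 _⊆′_
  _⊆′_ : M → M → Set
  _⊆′_ = _⊆_ _∈_

  memberless-⊆ : ∀ {e x} → (∀ c → ¬ c ∈ e) → e ⊆′ x
  memberless-⊆ e-empty c c∈e = ⊥-elim (e-empty c c∈e)

  ∈∉⇒≢ : ∀ {c x y} → c ∈ x → ¬ c ∈ y → x ≢ y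
  ∈∉⇒≢ {c} c∈x c∉y x≡y = c∉y (subst (c ∈_) x≡y c∈x)

  union⇒lub : ∀ {x y z} → (∀ u → u ∈ z ⇔ (u ∈ x ⊎ u ∈ y)) → IsLub _⊆′_ x y z
  union⇒lub ∈-z = (λ u → from (∈-z u) ∘ inj₁) , (λ u → from (∈-z u) ∘ inj₂)
                , λ w x⊆w y⊆w u → [ x⊆w u , y⊆w u ] ∘ to (∈-z u)

  intersection⇒glb : ∀ {x y z} → (∀ u → u ∈ z ⇔ (u ∈ x × u ∈ y)) → IsGlb _⊆′_ x y z
  intersection⇒glb ∈-z = (λ u → proj₁ ∘ to (∈-z u)) , (λ u → proj₂ ∘ to (∈-z u))
                       , λ w w⊆x w⊆y u u∈w → from (∈-z u) (w⊆x u u∈w , w⊆y u u∈w)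

  module Adjunction (as : AS _∈_) where

    ∅ : M
    ∅ = proj₁ (proj₁ as)

    ∅-empty : ∀ c → ¬ c ∈ ∅
    ∅-empty = proj₂ (proj₁ as)

    adjoin : M → M → M
    adjoin x y = proj₁ (proj₂ as x y)

    ∈-adjoin : ∀ {x y u} → u ∈ adjoin x y ⇔ (u ∈ x ⊎ u ≡ y)
    ∈-adjoin {x} {y} {u} = proj₂ (proj₂ as x y) u

    ⟦_⟧ : M → M
    ⟦ c ⟧ = adjoin ∅ c

    ∈-⟦⟧ : ∀ {c u} → u ∈ ⟦ c ⟧ → u ≡ c
    ∈-⟦⟧ {c} {u} = [ (λ u∈∅ → ⊥-elim (∅-empty u u∈∅)) , id ] ∘ to ∈-adjoin

    c∈⟦c⟧ : ∀ c → c ∈ ⟦ c ⟧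
    c∈⟦c⟧ c = from ∈-adjoin (inj₂ refl)

    ⟦⟧-⊆ : ∀ {c x} → c ∈ x → ⟦ c ⟧ ⊆′ x
    ⟦⟧-⊆ c∈x u u∈⟦c⟧ = subst (_∈ _) (sym (∈-⟦⟧ u∈⟦c⟧)) c∈x

    glb⇒intersection : ∀ {x y m} → IsGlb _⊆′_ x y m → ∀ u → u ∈ m ⇔ (u ∈ x × u ∈ y)
    glb⇒intersection (m⊆x , m⊆y , greatest) u =
      mk⇔ (λ u∈m → m⊆x u u∈m , m⊆y u u∈m)
          (λ (u∈x , u∈y) → greatest ⟦ u ⟧ (⟦⟧-⊆ u∈x) (⟦⟧-⊆ u∈y) u (c∈⟦c⟧ u))

module MerOfBAS (lem : LEM) {M : Set} (_∈_ : M → M → Set)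
                (as : AS _∈_) (ext : Ext _∈_) (union : Union _∈_)
                (intersection : Intersection _∈_) (relComp : RelComp _∈_) (ub : UB _∈_) where
  open Membership _∈_
  open Adjunction as
  open EquationalReasoning {k = equivalence}

  infixl 22 _∩_ _∖_
  infixl 21 _∪_

  _∪_ _∩_ _∖_ : M → M → M
  x ∪ y = proj₁ (union x y)
  x ∩ y = proj₁ (intersection x y)
  x ∖ y = proj₁ (relComp x y)

  ∈-∪ : ∀ {x y u} → u ∈ x ∪ y ⇔ (u ∈ x ⊎ u ∈ y)
  ∈-∪ {x} {y} {u} = proj₂ (union x y) u

  ∈-∩ : ∀ {x y u} → u ∈ x ∩ y ⇔ (u ∈ x × u ∈ y)
  ∈-∩ {x} {y} {u} = proj₂ (intersection x y) u

  ∈-∖ : ∀ {x y u} → u ∈ x ∖ y ⇔ (u ∈ x × ¬ u ∈ y)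
  ∈-∖ {x} {y} {u} = proj₂ (relComp x y) u

  ≡-by-members : ∀ {x y} → (∀ u → u ∈ x ⇔ u ∈ y) → x ≡ y
  ≡-by-members = from (ext _ _)

  ⊆-antisym : ∀ {x y} → x ⊆′ y → y ⊆′ x → x ≡ y
  ⊆-antisym x⊆y y⊆x = ≡-by-members λ u → mk⇔ (x⊆y u) (y⊆x u)

  ≢∅⇒∃∈ : ∀ {x} → x ≢ ∅ → ∃ (_∈ x)
  ≢∅⇒∃∈ x≢∅ = decidable-stable (lem _) λ ∄u∈x →
    x≢∅ (⊆-antisym (memberless-⊆ λ u u∈x → ∄u∈x (u , u∈x)) (memberless-⊆ ∅-empty))

  ⟦⟧-atom : ∀ c b → b ⊆′ ⟦ c ⟧ → b ≡ ∅ ⊎ b ≡ ⟦ c ⟧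
  ⟦⟧-atom c b b⊆⟦c⟧ with lem (c ∈ b)
  ... | yes c∈b = inj₂ (⊆-antisym b⊆⟦c⟧ (⟦⟧-⊆ c∈b))
  ... | no  c∉b = inj₁ (⊆-antisym b⊆∅ (memberless-⊆ ∅-empty))
    where
      b⊆∅ : b ⊆′ ∅
      b⊆∅ u u∈b = ⊥-elim (c∉b (subst (_∈ b) (∈-⟦⟧ (b⊆⟦c⟧ u u∈b)) u∈b))

  ∩-∖-disjoint : ∀ x y → y ∩ (x ∖ y) ≡ ∅
  ∩-∖-disjoint x y = ⊆-antisym (memberless-⊆ λ u u∈y∩x∖y →
    let (u∈y , u∈x∖y) = to ∈-∩ u∈y∩x∖y in proj₂ (to ∈-∖ u∈x∖y) u∈y) (memberless-⊆ ∅-empty)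

  ∩-∪-∖ : ∀ x y → x ≡ x ∩ y ∪ x ∖ y
  ∩-∪-∖ x y = ⊆-antisym split (λ u → [ proj₁ ∘ to ∈-∩ , proj₁ ∘ to ∈-∖ ] ∘ to ∈-∪)
    where
      split : x ⊆′ x ∩ y ∪ x ∖ y
      split u u∈x with lem (u ∈ y)
      ... | yes u∈y = from ∈-∪ (inj₁ (from ∈-∩ (u∈x , u∈y)))
      ... | no  u∉y = from ∈-∪ (inj₂ (from ∈-∖ (u∈x , u∉y)))

  ∩-distribˡ-∪ : ∀ x y z → x ∩ (y ∪ z) ≡ x ∩ y ∪ x ∩ z
  ∩-distribˡ-∪ x y z = ≡-by-members λ u → begin
    u ∈ x ∩ (y ∪ z)                   ∼⟨ ∈-∩ ⟩
    (u ∈ x × u ∈ y ∪ z)               ∼⟨ ⇔-id _ ×-⇔ ∈-∪ ⟩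
    (u ∈ x × (u ∈ y ⊎ u ∈ z))         ↔⟨ ×-distribˡ-⊎ _ _ _ _ ⟩
    ((u ∈ x × u ∈ y) ⊎ (u ∈ x × u ∈ z)) ∼⟨ ⇔-sym (∈-∩ ⊎-⇔ ∈-∩) ⟩
    (u ∈ x ∩ y ⊎ u ∈ x ∩ z)           ∼⟨ ⇔-sym ∈-∪ ⟩
    u ∈ x ∩ y ∪ x ∩ z                 ∎

  ∪-distribˡ-∩ : ∀ x y z → x ∪ y ∩ z ≡ (x ∪ y) ∩ (x ∪ z)
  ∪-distribˡ-∩ x y z = ≡-by-members λ u → begin
    u ∈ x ∪ y ∩ z                     ∼⟨ ∈-∪ ⟩
    (u ∈ x ⊎ u ∈ y ∩ z)               ∼⟨ ⇔-id _ ⊎-⇔ ∈-∩ ⟩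
    (u ∈ x ⊎ (u ∈ y × u ∈ z))         ∼⟨ ⊎-distribˡ-× ⟩
    ((u ∈ x ⊎ u ∈ y) × (u ∈ x ⊎ u ∈ z)) ∼⟨ ⇔-sym (∈-∪ ×-⇔ ∈-∪) ⟩
    (u ∈ x ∪ y × u ∈ x ∪ z)           ∼⟨ ⇔-sym ∈-∩ ⟩
    u ∈ (x ∪ y) ∩ (x ∪ z)             ∎

  ⊆-mer : Mer _⊆′_
  ⊆-mer = record
    { ⊑-refl     = λ _ _ u∈x → u∈x
    ; ⊑-trans    = λ _ _ _ x⊆y y⊆z u → y⊆z u ∘ x⊆y u
    ; ⊑-antisym  = λ _ _ → ⊆-antisym
    ; least      = ∅ , λ _ → memberless-⊆ ∅-empty
    ; join       = λ x y → x ∪ y , union⇒lub λ _ → ∈-∪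
    ; meet       = λ x y → x ∩ y , intersection⇒glb λ _ → ∈-∩
    ; atomic     = λ x x≢∅ → let (c , c∈x) = ≢∅⇒∃∈ x≢∅ in
                     ⟦ c ⟧ , (∈∉⇒≢ (c∈⟦c⟧ c) (∅-empty c) , ⟦⟧-atom c) , ⟦⟧-⊆ c∈x
    ; unbounded  = λ x → let (y , y∉x) = ub x in
                     adjoin x y , ∈∉⇒≢ (from ∈-adjoin (inj₂ refl)) y∉x , λ _ → from ∈-adjoin ∘ inj₁
    ; relCompl   = λ x y → x ∖ y , ∩-∖-disjoint x y , ∩-∪-∖ x y
    ; distrib-∧∨ = ∩-distribˡ-∪
    ; distrib-∨∧ = ∪-distribˡ-∩
    }

module BASOfMer (lem : LEM) {M : Set} (_∈_ : M → M → Set) (as : AS _∈_)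
                (mer : Mer (_⊆_ _∈_)) where
  open Membership _∈_
  open Adjunction as
  open Mer mer
  open MerProperties mer

  ∉𝟘 : ∀ c → ¬ c ∈ 𝟘
  ∉𝟘 c c∈𝟘 = ∅-empty c (proj₂ least ∅ c c∈𝟘)

  ∈-∧̇ : ∀ {x y u} → u ∈ (x ∧̇ y) ⇔ (u ∈ x × u ∈ y)
  ∈-∧̇ {x} {y} {u} = glb⇒intersection (proj₂ (meet x y)) u

  ∧̇≡𝟘⇒disjoint : ∀ {x y u} → x ∧̇ y ≡ 𝟘 → u ∈ x → ¬ u ∈ y
  ∧̇≡𝟘⇒disjoint {u = u} x∧̇y≡𝟘 u∈x u∈y = ∉𝟘 u (subst (u ∈_) x∧̇y≡𝟘 (from ∈-∧̇ (u∈x , u∈y)))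

  ∈-∨̇⁻ : ∀ {x y c} → c ∈ (x ∨̇ y) → c ∈ x ⊎ c ∈ y
  ∈-∨̇⁻ {x} {y} {c} c∈x∨̇y with relCompl (x ∨̇ y) ⟦ c ⟧
  ... | z , ⟦c⟧∧̇z≡𝟘 , x∨̇y≡split = decidable-stable (lem _) λ c∉x⊎y →
    ∧̇≡𝟘⇒disjoint ⟦c⟧∧̇z≡𝟘 (c∈⟦c⟧ c)
      (∨̇-least (⊆z (c∉x⊎y ∘ inj₁) (x⊑x∨̇y x y)) (⊆z (c∉x⊎y ∘ inj₂) (y⊑x∨̇y x y)) c c∈x∨̇y)
    where
      ⊆z : ∀ {w} → ¬ c ∈ w → w ⊆′ x ∨̇ y → w ⊆′ z
      ⊆z {w} c∉w w⊆x∨̇y = ⊑-∨̇-cancelˡ (subst (w ⊆′_) x∨̇y≡split w⊆x∨̇y) (memberless-⊆ λ u u∈ →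
        let (u∈w , u∈x∨̇y∧̇⟦c⟧) = to ∈-∧̇ u∈
        in c∉w (subst (_∈ w) (∈-⟦⟧ (proj₂ (to ∈-∧̇ u∈x∨̇y∧̇⟦c⟧))) u∈w))

  ∈-∨̇ : ∀ {x y u} → u ∈ (x ∨̇ y) ⇔ (u ∈ x ⊎ u ∈ y)
  ∈-∨̇ {x} {y} {u} = mk⇔ ∈-∨̇⁻ [ x⊑x∨̇y x y u , y⊑x∨̇y x y u ]

  ⊆-ext : Ext _∈_
  ⊆-ext x y = mk⇔ (λ { refl u → ⇔-id _ }) λ same → ⊑-antisym x y (to ∘ same) (from ∘ same)

  ⊆-relComp : RelComp _∈_
  ⊆-relComp x y with relCompl x y
  ... | z , y∧̇z≡𝟘 , x≡x∧̇y∨̇z = z , λ u → mk⇔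
      (λ u∈z → subst (u ∈_) (sym x≡x∧̇y∨̇z) (y⊑x∨̇y _ z u u∈z) , λ u∈y → ∧̇≡𝟘⇒disjoint y∧̇z≡𝟘 u∈y u∈z)
      (λ (u∈x , u∉y) → [ (λ u∈x∧̇y → ⊥-elim (u∉y (proj₂ (to ∈-∧̇ u∈x∧̇y)))) , id ]
                          (to ∈-∨̇ (subst (u ∈_) x≡x∧̇y∨̇z u∈x)))

  ⊆-ub : UB _∈_
  ⊆-ub x with unbounded x
  ... | y , y≢x , x⊆y = decidable-stable (lem _) λ ∄u∉x →
    y≢x (⊑-antisym y x (λ u u∈y → decidable-stable (lem _) λ u∉x → ∄u∉x (u , u∉x)) x⊆y)

  ⊆-bas : BAS _∈_
  ⊆-bas = as , ⊆-ext , (λ x y → x ∨̇ y , λ _ → ∈-∨̇) , (λ x y → x ∧̇ y , λ _ → ∈-∧̇) , ⊆-relComp , ⊆-ub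

mainTheorem4 : LEM → (M : Set) (_∈_ : M → M → Set) →
    AS _∈_ → (BAS _∈_ ⇔ Mer (_⊆_ _∈_))
mainTheorem4 lem M _∈_ as = mk⇔
  (λ (as′ , ext , union , intersection , relComp , ub) →
     MerOfBAS.⊆-mer lem _∈_ as′ ext union intersection relComp ub)
  (BASOfMer.⊆-bas lem _∈_ as)
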